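{- For every integer $n\ge 0$, $$m_n=\sum_{k=0}^{n}\binom{n}{k}d_k,$$ where $d_n$ denotes the number of symmetric Dyck paths of length $2n$ and $m_n$ denotes the number of symmetric Motzkin paths of length $2n$.
   Context: Steps: up step $U=(1,1)$, down step $D=(1,-1)$, horizontal step $h=(1,0)$. A Dyck path of length $2n$ is a lattice path from $(0,0)$ to $(2n,0)$ using steps $U,D$ that never goes below the $x$-axis; a Motzkin path of length $2n$ is the same but steps $U,D,h$ are allowed. A path of length $2n$ is symmetric if it passes through a lattice point with $x$-coordinate $n$ and its part on $[n,2n]$ is the mirror image of its part on $[0,n]$ under the reflection $x\mapsto 2n-x$ (equivalently, reading the path right-to-left gives the same path, with a vertex in the middle). Thus $d_n=\binom{n}{\lfloor n/2\rfloor}$ counts symmetric Dyck paths of length $2n$ ($1,1,2,3,6,10,\dots$) and $m_n$ counts symmetric Motzkin paths of length $2n$ ($1,2,5,13,35,\dots$). -}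

module Defs where

open import Data.Nat using (ℕ; zero; suc; _+_; _*_)
open import Data.Bool using (Bool; true; false; _∧_; not)
open import Data.List using (List; []; _∷_; map; concatMap; reverse; filter; length; sum; upTo)
open import Relation.Nullary.Decidable using (Dec; yes; no)
open import Relation.Binary.PropositionalEquality using (_≡_)
open import Data.Bool.Properties using () renaming (_≟_ to _≟ᵇ_)

-- Steps: U = (1,1), D = (1,-1), H = (1,0)
data Step : Set where
  U D H : Step

words : ℕ → List (List Step)
words zero    = [] ∷ []
words (suc n) = concatMap (λ w → (U ∷ w) ∷ (D ∷ w) ∷ (H ∷ w) ∷ []) (words n)

staysAndReturns : ℕ → List Step → Bool
staysAndReturns zero    []       = true
staysAndReturns (suc _) []       = false
staysAndReturns h       (U ∷ w)  = staysAndReturns (suc h) w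
staysAndReturns zero    (D ∷ w)  = false
staysAndReturns (suc h) (D ∷ w)  = staysAndReturns h w
staysAndReturns h       (H ∷ w)  = staysAndReturns h w

isMotzkin : List Step → Bool
isMotzkin = staysAndReturns 0

noH : List Step → Bool
noH []      = true
noH (H ∷ _) = false
noH (_ ∷ w) = noH w

isDyck : List Step → Bool
isDyck w = noH w ∧ isMotzkin w

-- Mirror image under x ↦ 2n - x: reverse the order, an up step becomes a down step.
flipStep : Step → Step
flipStep U = D
flipStep D = U
flipStep H = H

mirror : List Step → List Step
mirror w = reverse (map flipStep w)

stepEq : Step → Step → Bool
stepEq U U = true
stepEq D D = true
stepEq H H = true
stepEq _ _ = false

wordEq : List Step → List Step → Bool
wordEq []      []      = true
wordEq (a ∷ v) (b ∷ w) = stepEq a b ∧ wordEq v w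
wordEq _       _       = false

isSymmetric : List Step → Bool
isSymmetric w = wordEq (mirror w) w

count : (List Step → Bool) → List (List Step) → ℕ
count p []      = 0
count p (w ∷ ws) with p w
... | true  = suc (count p ws)
... | false = count p ws

d : ℕ → ℕ
d n = count (λ w → isDyck w ∧ isSymmetric w) (words (n + n))

m : ℕ → ℕ
m n = count (λ w → isMotzkin w ∧ isSymmetric w) (words (n + n))

module Submission where

-- A symmetric path of length 2n is determined by its first half v, being
-- v ++ mirror v; it is a Motzkin path exactly when v never goes below the
-- axis (v is a "meander", ending at any height), and a Dyck path when
-- moreover v has no flat step.  So m n and d n count Motzkin and Dyck
-- meanders of length n starting at height 0.
--
-- Finally, Motzkin
-- meanders from height h satisfy the recurrence "up + down + flat", Dyck
-- meanders satisfy "up + down", and the binomial sum satisfies Pascal's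
-- recursion; induction on the length then gives
--   meanders h n = Σ_k C(n,k) · dyckMeanders h k,
-- whose case h = 0 is the theorem.

open import Defs
open import Data.Nat using (ℕ; zero; suc; _+_; _*_)
open import Data.Nat.Properties
  using (+-identityʳ; +-assoc; +-commutativeSemigroup; *-distribˡ-+; *-distribʳ-+; suc-injective; n<1+n)
open import Data.Nat.Combinatorics using (_C_; nCk+nC[k+1]≡[n+1]C[k+1]; k>n⇒nCk≡0)
open import Data.Nat.ListAction using (sum)
open import Data.Nat.ListAction.Properties using (sum-++)
open import Data.Bool using (Bool; true; false; _∧_)
open import Data.Bool.Properties using (∧-identityʳ; ∧-zeroʳ; ∧-comm; ∧-idem)
open import Data.Maybe using (Maybe; just; nothing; is-just; _>>=_)
open import Data.List using (List; []; _∷_; _++_; _∷ʳ_; map; reverse; length; concatMap; upTo; applyUpTo)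
open import Data.List.Properties
  using (map-++; map-cong; map-∘; map-id; reverse-++; reverse-map; reverse-involutive;
         length-reverse; length-map; unfold-reverse; ∷-injectiveˡ; ∷-injectiveʳ; map-upTo; upTo-∷ʳ)
open import Data.Empty using (⊥-elim)
open import Function using (_∘_)
open import Relation.Binary.PropositionalEquality
  using (_≡_; _≢_; refl; sym; trans; cong; cong₂; subst; module ≡-Reasoning)
open import Algebra.Properties.CommutativeSemigroup +-commutativeSemigroup using (interchange; x∙yz≈y∙xz)

open ≡-Reasoning

indicator : Bool → ℕ
indicator true  = 1
indicator false = 0

count-as-sum : ∀ (p : List Step → Bool) ws → count p ws ≡ sum (map (indicator ∘ p) ws)
count-as-sum p []       = refl
count-as-sum p (w ∷ ws) with p w
... | true  = cong suc (count-as-sum p ws)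
... | false = count-as-sum p ws

sum-map-+ : ∀ {A : Set} (f g : A → ℕ) xs →
            sum (map (λ x → f x + g x) xs) ≡ sum (map f xs) + sum (map g xs)
sum-map-+ f g []       = refl
sum-map-+ f g (x ∷ xs) =
  trans (cong (f x + g x +_) (sum-map-+ f g xs)) (interchange (f x) (g x) _ _)

sumBelow : ℕ → (ℕ → ℕ) → ℕ
sumBelow N f = sum (map f (upTo N))

sumBelow-cong : ∀ N {f g : ℕ → ℕ} → (∀ k → f k ≡ g k) → sumBelow N f ≡ sumBelow N g
sumBelow-cong N e = cong sum (map-cong e (upTo N))

sumBelow-first : ∀ N (f : ℕ → ℕ) → sumBelow (suc N) f ≡ f 0 + sumBelow N (f ∘ suc)
sumBelow-first N f = cong sum (begin
  map f (upTo (suc N))            ≡⟨ map-upTo f (suc N) ⟩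
  f 0 ∷ applyUpTo (f ∘ suc) N     ≡⟨ cong (f 0 ∷_) (sym (map-upTo (f ∘ suc) N)) ⟩
  f 0 ∷ map (f ∘ suc) (upTo N)    ∎)

sumBelow-last : ∀ N (f : ℕ → ℕ) → sumBelow (suc N) f ≡ sumBelow N f + f N
sumBelow-last N f = begin
  sum (map f (upTo (suc N)))          ≡⟨ cong (sum ∘ map f) (sym (upTo-∷ʳ N)) ⟩
  sum (map f (upTo N ∷ʳ N))           ≡⟨ cong sum (map-++ f (upTo N) (N ∷ [])) ⟩
  sum (map f (upTo N) ∷ʳ f N)         ≡⟨ sum-++ (map f (upTo N)) (f N ∷ []) ⟩
  sumBelow N f + (f N + 0)            ≡⟨ cong (sumBelow N f +_) (+-identityʳ (f N)) ⟩
  sumBelow N f + f N                  ∎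

binomialSum : ℕ → (ℕ → ℕ) → ℕ
binomialSum n g = sumBelow (suc n) (λ k → (n C k) * g k)

binomialSum-cong : ∀ n {f g : ℕ → ℕ} → (∀ k → f k ≡ g k) → binomialSum n f ≡ binomialSum n g
binomialSum-cong n e = sumBelow-cong (suc n) (λ k → cong ((n C k) *_) (e k))

binomialSum-+ : ∀ n (f g : ℕ → ℕ) →
                binomialSum n (λ k → f k + g k) ≡ binomialSum n f + binomialSum n g
binomialSum-+ n f g = trans (sumBelow-cong (suc n) (λ k → *-distribˡ-+ (n C k) (f k) (g k)))
                            (sum-map-+ (λ k → (n C k) * f k) (λ k → (n C k) * g k) (upTo (suc n)))

-- Reindexing from k + 1, using that the extra top term C(n, n+1) vanishes.
binomialSum-shift : ∀ n (g : ℕ → ℕ) →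
                    binomialSum n g ≡ (n C 0) * g 0 + sumBelow (suc n) (λ k → (n C suc k) * g (suc k))
binomialSum-shift n g = begin
  binomialSum n g                                   ≡⟨ sym (+-identityʳ _) ⟩
  binomialSum n g + 0                               ≡⟨ cong (binomialSum n g +_) (sym topTerm) ⟩
  binomialSum n g + (n C suc n) * g (suc n)           ≡⟨ sym (sumBelow-last (suc n) (λ k → (n C k) * g k)) ⟩
  sumBelow (suc (suc n)) (λ k → (n C k) * g k)        ≡⟨ sumBelow-first (suc n) (λ k → (n C k) * g k) ⟩
  (n C 0) * g 0 + sumBelow (suc n) (λ k → (n C suc k) * g (suc k)) ∎
  where
  topTerm : (n C suc n) * g (suc n) ≡ 0
  topTerm = cong (_* g (suc n)) (k>n⇒nCk≡0 (n<1+n n))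

binomialSum-pascal : ∀ n (g : ℕ → ℕ) →
                     binomialSum (suc n) g ≡ binomialSum n (g ∘ suc) + binomialSum n g
binomialSum-pascal n g = begin
  binomialSum (suc n) g
    ≡⟨ sumBelow-first (suc n) (λ k → (suc n C k) * g k) ⟩
  g₀ + sumBelow (suc n) (λ k → (suc n C suc k) * g (suc k))
    ≡⟨ cong (g₀ +_) (sumBelow-cong (suc n) pascal) ⟩
  g₀ + sumBelow (suc n) (λ k → (n C k) * g (suc k) + (n C suc k) * g (suc k))
    ≡⟨ cong (g₀ +_) (sum-map-+ (λ k → (n C k) * g (suc k)) (λ k → (n C suc k) * g (suc k)) (upTo (suc n))) ⟩
  g₀ + (binomialSum n (g ∘ suc) + rest)
    ≡⟨ x∙yz≈y∙xz g₀ (binomialSum n (g ∘ suc)) rest ⟩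
  binomialSum n (g ∘ suc) + (g₀ + rest)
    ≡⟨ cong (binomialSum n (g ∘ suc) +_) (sym (binomialSum-shift n g)) ⟩
  binomialSum n (g ∘ suc) + binomialSum n g ∎
  where
  g₀   = (n C 0) * g 0
  rest = sumBelow (suc n) (λ k → (n C suc k) * g (suc k))
  pascal : ∀ k → (suc n C suc k) * g (suc k) ≡ (n C k) * g (suc k) + (n C suc k) * g (suc k)
  pascal k = trans (cong (_* g (suc k)) (sym (nCk+nC[k+1]≡[n+1]C[k+1] n k)))
                   (*-distribʳ-+ (g (suc k)) (n C k) (n C suc k))

steps : List Step
steps = U ∷ D ∷ H ∷ []

sumWords : ℕ → (List Step → ℕ) → ℕ
sumWords zero    f = f []
sumWords (suc n) f = sum (map (λ a → sumWords n (λ w → f (a ∷ w))) steps)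

sum-extensions : ∀ (f : List Step → ℕ) ws →
                 sum (map f (concatMap (λ w → map (_∷ w) steps) ws))
                   ≡ sum (map (λ a → sum (map (λ w → f (a ∷ w)) ws)) steps)
sum-extensions f []       = refl
sum-extensions f (w ∷ ws) = begin
  sum (map f (map (_∷ w) steps ++ rest))
    ≡⟨ cong sum (map-++ f (map (_∷ w) steps) rest) ⟩
  sum (map f (map (_∷ w) steps) ++ map f rest)
    ≡⟨ sum-++ (map f (map (_∷ w) steps)) (map f rest) ⟩
  sum (map (λ a → f (a ∷ w)) steps) + sum (map f rest)
    ≡⟨ cong (sum (map (λ a → f (a ∷ w)) steps) +_) (sum-extensions f ws) ⟩
  sum (map (λ a → f (a ∷ w)) steps) + sum (map (λ a → sum (map (λ v → f (a ∷ v)) ws)) steps)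
    ≡⟨ sym (sum-map-+ (λ a → f (a ∷ w)) (λ a → sum (map (λ v → f (a ∷ v)) ws)) steps) ⟩
  sum (map (λ a → sum (map (λ v → f (a ∷ v)) (w ∷ ws))) steps) ∎
  where rest = concatMap (λ w → map (_∷ w) steps) ws

sum-words : ∀ n (f : List Step → ℕ) → sum (map f (words n)) ≡ sumWords n f
sum-words zero    f = +-identityʳ (f [])
sum-words (suc n) f =
  trans (sum-extensions f (words n)) (cong sum (map-cong (λ a → sum-words n (λ w → f (a ∷ w))) steps))

sumWords-cong : ∀ n (f g : List Step → ℕ) → (∀ w → length w ≡ n → f w ≡ g w) →
                sumWords n f ≡ sumWords n g
sumWords-cong zero    f g e = e [] refl
sumWords-cong (suc n) f g e =
  cong sum (map-cong (λ a → sumWords-cong n _ _ (λ w l → e (a ∷ w) (cong suc l))) steps)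

sumWords-vanish : ∀ n (f : List Step → ℕ) → (∀ w → length w ≡ n → f w ≡ 0) → sumWords n f ≡ 0
sumWords-vanish zero    f z = z [] refl
sumWords-vanish (suc n) f z =
  cong sum (map-cong (λ a → sumWords-vanish n _ (λ w l → z (a ∷ w) (cong suc l))) steps)

sum-steps-single : ∀ (g : Step → ℕ) a → (∀ b → b ≢ a → g b ≡ 0) → sum (map g steps) ≡ g a
sum-steps-single g U z rewrite z D (λ ()) | z H (λ ()) = +-identityʳ (g U)
sum-steps-single g D z rewrite z U (λ ()) | z H (λ ()) = +-identityʳ (g D)
sum-steps-single g H z rewrite z U (λ ()) | z D (λ ()) = +-identityʳ (g H)

sumWords-single : ∀ n t (f : List Step → ℕ) → length t ≡ n →
                  (∀ w → length w ≡ n → w ≢ t → f w ≡ 0) → sumWords n f ≡ f t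
sumWords-single zero    []      f _ _ = refl
sumWords-single (suc n) (a ∷ t) f l z = begin
  sumWords (suc n) f              ≡⟨ sum-steps-single _ a otherSteps ⟩
  sumWords n (λ w → f (a ∷ w))    ≡⟨ sumWords-single n t _ (suc-injective l) sameStep ⟩
  f (a ∷ t)                       ∎
  where
  otherSteps : ∀ b → b ≢ a → sumWords n (λ w → f (b ∷ w)) ≡ 0
  otherSteps b b≢a = sumWords-vanish n _ (λ w lw → z (b ∷ w) (cong suc lw) (b≢a ∘ ∷-injectiveˡ))
  sameStep : ∀ w → length w ≡ n → w ≢ t → f (a ∷ w) ≡ 0
  sameStep w lw w≢t = z (a ∷ w) (cong suc lw) (w≢t ∘ ∷-injectiveʳ)

sumWords-split : ∀ a b (f : List Step → ℕ) →
                 sumWords (a + b) f ≡ sumWords a (λ v → sumWords b (λ u → f (v ++ u)))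
sumWords-split zero    b f = refl
sumWords-split (suc a) b f = cong sum (map-cong (λ s → sumWords-split a b (λ w → f (s ∷ w))) steps)

flipStep-involutive : ∀ a → flipStep (flipStep a) ≡ a
flipStep-involutive U = refl
flipStep-involutive D = refl
flipStep-involutive H = refl

mirror-cons : ∀ a v → mirror (a ∷ v) ≡ mirror v ++ flipStep a ∷ []
mirror-cons a v = unfold-reverse (flipStep a) (map flipStep v)

mirror-++ : ∀ v u → mirror (v ++ u) ≡ mirror u ++ mirror v
mirror-++ v u = trans (cong reverse (map-++ flipStep v u)) (reverse-++ (map flipStep v) (map flipStep u))

mirror-involutive : ∀ v → mirror (mirror v) ≡ v
mirror-involutive v = begin
  reverse (map flipStep (reverse (map flipStep v)))  ≡⟨ cong reverse (reverse-map flipStep (map flipStep v)) ⟩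
  reverse (reverse (map flipStep (map flipStep v)))  ≡⟨ reverse-involutive _ ⟩
  map flipStep (map flipStep v)                      ≡⟨ sym (map-∘ v) ⟩
  map (flipStep ∘ flipStep) v                        ≡⟨ map-cong flipStep-involutive v ⟩
  map (λ a → a) v                                    ≡⟨ map-id v ⟩
  v                                                  ∎

length-mirror : ∀ v → length (mirror v) ≡ length v
length-mirror v = trans (length-reverse (map flipStep v)) (length-map flipStep v)

++-cancel-prefix : ∀ {A : Set} (xs ys zs ws : List A) →
                   length xs ≡ length ys → xs ++ zs ≡ ys ++ ws → zs ≡ ws
++-cancel-prefix []       []       zs ws _ e = e
++-cancel-prefix (x ∷ xs) (y ∷ ys) zs ws l e =
  ++-cancel-prefix xs ys zs ws (suc-injective l) (∷-injectiveʳ e)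

stepEq-sound : ∀ a b → stepEq a b ≡ true → a ≡ b
stepEq-sound U U _ = refl
stepEq-sound D D _ = refl
stepEq-sound H H _ = refl
stepEq-sound U D ()
stepEq-sound U H ()
stepEq-sound D U ()
stepEq-sound D H ()
stepEq-sound H U ()
stepEq-sound H D ()

stepEq-refl : ∀ a → stepEq a a ≡ true
stepEq-refl U = refl
stepEq-refl D = refl
stepEq-refl H = refl

wordEq-sound : ∀ x y → wordEq x y ≡ true → x ≡ y
wordEq-sound []      []      _ = refl
wordEq-sound (a ∷ x) (b ∷ y) e with stepEq a b in a≡b
... | true  = cong₂ _∷_ (stepEq-sound a b a≡b) (wordEq-sound x y e)
wordEq-sound (a ∷ x) (b ∷ y) () | false

wordEq-refl : ∀ x → wordEq x x ≡ true
wordEq-refl []      = refl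
wordEq-refl (a ∷ x) rewrite stepEq-refl a = wordEq-refl x

isSymmetric-sound : ∀ w → isSymmetric w ≡ true → mirror w ≡ w
isSymmetric-sound w = wordEq-sound (mirror w) w

isSymmetric-complete : ∀ w → mirror w ≡ w → isSymmetric w ≡ true
isSymmetric-complete w e = subst (λ x → wordEq x w ≡ true) (sym e) (wordEq-refl w)

symmetric-second-half : ∀ v u → length u ≡ length v → mirror (v ++ u) ≡ v ++ u → u ≡ mirror v
symmetric-second-half v u l e = sym (++-cancel-prefix (mirror u) v (mirror v) u
  (trans (length-mirror u) l) (trans (sym (mirror-++ v u)) e))

doubled-symmetric : ∀ v → mirror (v ++ mirror v) ≡ v ++ mirror v
doubled-symmetric v = trans (mirror-++ v (mirror v)) (cong (_++ mirror v) (mirror-involutive v))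

symmetric-count : ∀ (Q : List Step → Bool) n →
  count (λ w → Q w ∧ isSymmetric w) (words (n + n)) ≡ sumWords n (λ v → indicator (Q (v ++ mirror v)))
symmetric-count Q n = begin
  count P (words (n + n))                                  ≡⟨ count-as-sum P (words (n + n)) ⟩
  sum (map (indicator ∘ P) (words (n + n)))                ≡⟨ sum-words (n + n) (indicator ∘ P) ⟩
  sumWords (n + n) (indicator ∘ P)                         ≡⟨ sumWords-split n n (indicator ∘ P) ⟩
  sumWords n (λ v → sumWords n (λ u → indicator (P (v ++ u))))
    ≡⟨ sumWords-cong n _ _ secondHalves ⟩
  sumWords n (λ v → indicator (Q (v ++ mirror v)))         ∎
  where
  P : List Step → Bool
  P w = Q w ∧ isSymmetric w
  offMirror : ∀ v u → length v ≡ n → length u ≡ n → u ≢ mirror v → indicator (P (v ++ u)) ≡ 0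
  offMirror v u lv lu u≢ with isSymmetric (v ++ u) in symmetric
  ... | true  = ⊥-elim (u≢ (symmetric-second-half v u (trans lu (sym lv)) (isSymmetric-sound _ symmetric)))
  ... | false = cong indicator (∧-zeroʳ (Q (v ++ u)))
  secondHalves : ∀ v → length v ≡ n →
                 sumWords n (λ u → indicator (P (v ++ u))) ≡ indicator (Q (v ++ mirror v))
  secondHalves v lv = begin
    sumWords n (λ u → indicator (P (v ++ u)))
      ≡⟨ sumWords-single n (mirror v) _ (trans (length-mirror v) lv) (λ u lu → offMirror v u lv lu) ⟩
    indicator (Q (v ++ mirror v) ∧ isSymmetric (v ++ mirror v))
      ≡⟨ cong (λ b → indicator (Q (v ++ mirror v) ∧ b)) (isSymmetric-complete _ (doubled-symmetric v)) ⟩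
    indicator (Q (v ++ mirror v) ∧ true)
      ≡⟨ cong indicator (∧-identityʳ _) ⟩
    indicator (Q (v ++ mirror v)) ∎

walk : ℕ → List Step → Maybe ℕ
walk h       []      = just h
walk h       (U ∷ v) = walk (suc h) v
walk zero    (D ∷ v) = nothing
walk (suc h) (D ∷ v) = walk h v
walk h       (H ∷ v) = walk h v

endsAtZero : Maybe ℕ → Bool
endsAtZero (just zero) = true
endsAtZero _           = false

staysAndReturns-walk : ∀ h w → staysAndReturns h w ≡ endsAtZero (walk h w)
staysAndReturns-walk zero    []      = refl
staysAndReturns-walk (suc h) []      = refl
staysAndReturns-walk zero    (U ∷ w) = staysAndReturns-walk 1 w
staysAndReturns-walk (suc h) (U ∷ w) = staysAndReturns-walk (suc (suc h)) w
staysAndReturns-walk zero    (D ∷ w) = refl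
staysAndReturns-walk (suc h) (D ∷ w) = staysAndReturns-walk h w
staysAndReturns-walk zero    (H ∷ w) = staysAndReturns-walk zero w
staysAndReturns-walk (suc h) (H ∷ w) = staysAndReturns-walk (suc h) w

walk-++ : ∀ h v u → walk h (v ++ u) ≡ (walk h v >>= λ j → walk j u)
walk-++ h       []      u = refl
walk-++ h       (U ∷ v) u = walk-++ (suc h) v u
walk-++ zero    (D ∷ v) u = refl
walk-++ (suc h) (D ∷ v) u = walk-++ h v u
walk-++ h       (H ∷ v) u = walk-++ h v u

walk-mirror-cons : ∀ a v j → walk j (mirror (a ∷ v)) ≡ (walk j (mirror v) >>= λ i → walk i (flipStep a ∷ []))
walk-mirror-cons a v j = trans (cong (walk j) (mirror-cons a v)) (walk-++ j (mirror v) (flipStep a ∷ []))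

walk-mirror : ∀ v {k j} → walk k v ≡ just j → walk j (mirror v) ≡ just k
walk-mirror []      refl = refl
walk-mirror (U ∷ v)         {j = j} e = trans (walk-mirror-cons U v j) (cong (_>>= _) (walk-mirror v e))
walk-mirror (D ∷ v) {zero}          ()
walk-mirror (D ∷ v) {suc k} {j}     e = trans (walk-mirror-cons D v j) (cong (_>>= _) (walk-mirror v e))
walk-mirror (H ∷ v)         {j = j} e = trans (walk-mirror-cons H v j) (cong (_>>= _) (walk-mirror v e))

isMotzkin-doubled : ∀ v → isMotzkin (v ++ mirror v) ≡ is-just (walk 0 v)
isMotzkin-doubled v
  rewrite staysAndReturns-walk 0 (v ++ mirror v) | walk-++ 0 v (mirror v) with walk 0 v in e
... | nothing = refl
... | just j  rewrite walk-mirror v e = refl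

noH-++ : ∀ v u → noH (v ++ u) ≡ noH v ∧ noH u
noH-++ []      u = refl
noH-++ (U ∷ v) u = noH-++ v u
noH-++ (D ∷ v) u = noH-++ v u
noH-++ (H ∷ v) u = refl

noH-flip : ∀ a → noH (flipStep a ∷ []) ≡ noH (a ∷ [])
noH-flip U = refl
noH-flip D = refl
noH-flip H = refl

noH-mirror : ∀ v → noH (mirror v) ≡ noH v
noH-mirror []      = refl
noH-mirror (a ∷ v) = begin
  noH (mirror (a ∷ v))                    ≡⟨ cong noH (mirror-cons a v) ⟩
  noH (mirror v ++ flipStep a ∷ [])       ≡⟨ noH-++ (mirror v) (flipStep a ∷ []) ⟩
  noH (mirror v) ∧ noH (flipStep a ∷ [])  ≡⟨ cong₂ _∧_ (noH-mirror v) (noH-flip a) ⟩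
  noH v ∧ noH (a ∷ [])                    ≡⟨ ∧-comm (noH v) (noH (a ∷ [])) ⟩
  noH (a ∷ []) ∧ noH v                    ≡⟨ sym (noH-++ (a ∷ []) v) ⟩
  noH (a ∷ v)                             ∎

isDyck-doubled : ∀ v → isDyck (v ++ mirror v) ≡ noH v ∧ is-just (walk 0 v)
isDyck-doubled v = cong₂ _∧_ noFlatSteps (isMotzkin-doubled v)
  where
  noFlatSteps : noH (v ++ mirror v) ≡ noH v
  noFlatSteps = begin
    noH (v ++ mirror v)      ≡⟨ noH-++ v (mirror v) ⟩
    noH v ∧ noH (mirror v)   ≡⟨ cong (noH v ∧_) (noH-mirror v) ⟩
    noH v ∧ noH v            ≡⟨ ∧-idem (noH v) ⟩
    noH v                    ∎

meanders : ℕ → ℕ → ℕ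
meanders h n = sumWords n (λ v → indicator (is-just (walk h v)))

dyckMeanders : ℕ → ℕ → ℕ
dyckMeanders h n = sumWords n (λ v → indicator (noH v ∧ is-just (walk h v)))

m-as-meanders : ∀ n → m n ≡ meanders 0 n
m-as-meanders n =
  trans (symmetric-count isMotzkin n) (sumWords-cong n _ _ (λ v _ → cong indicator (isMotzkin-doubled v)))

d-as-meanders : ∀ n → d n ≡ dyckMeanders 0 n
d-as-meanders n =
  trans (symmetric-count isDyck n) (sumWords-cong n _ _ (λ v _ → cong indicator (isDyck-doubled v)))

-- First-step recurrences.  From height 0 a down step is impossible.
meanders-zero-suc : ∀ n → meanders 0 (suc n) ≡ meanders 1 n + meanders 0 n
meanders-zero-suc n = cong (meanders 1 n +_)
  (trans (cong (_+ (meanders 0 n + 0)) (sumWords-vanish n _ (λ _ _ → refl))) (+-identityʳ _))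

meanders-suc-suc : ∀ h n → meanders (suc h) (suc n) ≡ (meanders (suc (suc h)) n + meanders h n) + meanders (suc h) n
meanders-suc-suc h n =
  trans (cong (λ x → meanders (suc (suc h)) n + (meanders h n + x)) (+-identityʳ (meanders (suc h) n)))
        (sym (+-assoc (meanders (suc (suc h)) n) (meanders h n) (meanders (suc h) n)))

dyckMeanders-zero-suc : ∀ k → dyckMeanders 0 (suc k) ≡ dyckMeanders 1 k
dyckMeanders-zero-suc k = trans (cong (dyckMeanders 1 k +_) (cong₂ _+_ noDown (cong (_+ 0) noFlat))) (+-identityʳ _)
  where
  noDown : sumWords k (λ v → indicator (noH v ∧ false)) ≡ 0
  noDown = sumWords-vanish k _ (λ v _ → cong indicator (∧-zeroʳ (noH v)))
  noFlat : sumWords k (λ _ → 0) ≡ 0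
  noFlat = sumWords-vanish k _ (λ _ _ → refl)

dyckMeanders-suc-suc : ∀ h k → dyckMeanders (suc h) (suc k) ≡ dyckMeanders (suc (suc h)) k + dyckMeanders h k
dyckMeanders-suc-suc h k = cong (dyckMeanders (suc (suc h)) k +_)
  (trans (cong (λ x → dyckMeanders h k + (x + 0)) (sumWords-vanish k _ (λ _ _ → refl))) (+-identityʳ _))

-- A Motzkin meander is a Dyck meander with flat steps inserted:
--   meanders h n = Σ_k C(n,k) · dyckMeanders h k.
meanders-binomial : ∀ n h → meanders h n ≡ binomialSum n (dyckMeanders h)
meanders-binomial zero    h       = refl
meanders-binomial (suc n) zero    = begin
  meanders 0 (suc n)
    ≡⟨ meanders-zero-suc n ⟩
  meanders 1 n + meanders 0 n
    ≡⟨ cong₂ _+_ (meanders-binomial n 1) (meanders-binomial n 0) ⟩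
  binomialSum n (dyckMeanders 1) + binomialSum n (dyckMeanders 0)
    ≡⟨ cong (_+ binomialSum n (dyckMeanders 0)) (binomialSum-cong n (λ k → sym (dyckMeanders-zero-suc k))) ⟩
  binomialSum n (dyckMeanders 0 ∘ suc) + binomialSum n (dyckMeanders 0)
    ≡⟨ sym (binomialSum-pascal n (dyckMeanders 0)) ⟩
  binomialSum (suc n) (dyckMeanders 0) ∎
meanders-binomial (suc n) (suc h) = begin
  meanders (suc h) (suc n)
    ≡⟨ meanders-suc-suc h n ⟩
  (meanders (suc (suc h)) n + meanders h n) + meanders (suc h) n
    ≡⟨ cong₂ _+_ (cong₂ _+_ (meanders-binomial n (suc (suc h))) (meanders-binomial n h))
                 (meanders-binomial n (suc h)) ⟩
  (binomialSum n (dyckMeanders (suc (suc h))) + binomialSum n (dyckMeanders h)) + binomialSum n (dyckMeanders (suc h))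
    ≡⟨ cong (_+ binomialSum n (dyckMeanders (suc h))) (sym (binomialSum-+ n (dyckMeanders (suc (suc h))) (dyckMeanders h))) ⟩
  binomialSum n (λ k → dyckMeanders (suc (suc h)) k + dyckMeanders h k) + binomialSum n (dyckMeanders (suc h))
    ≡⟨ cong (_+ binomialSum n (dyckMeanders (suc h))) (binomialSum-cong n (λ k → sym (dyckMeanders-suc-suc h k))) ⟩
  binomialSum n (dyckMeanders (suc h) ∘ suc) + binomialSum n (dyckMeanders (suc h))
    ≡⟨ sym (binomialSum-pascal n (dyckMeanders (suc h))) ⟩
  binomialSum (suc n) (dyckMeanders (suc h)) ∎

theorem3p1 : (n : ℕ) → m n ≡ sum (map (λ k → (n C k) * d k) (upTo (suc n)))
theorem3p1 n = begin
  m n                               ≡⟨ m-as-meanders n ⟩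
  meanders 0 n                      ≡⟨ meanders-binomial n 0 ⟩
  binomialSum n (dyckMeanders 0)    ≡⟨ binomialSum-cong n (λ k → sym (d-as-meanders k)) ⟩
  binomialSum n d                   ∎
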